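{- There is no finite set $\Phi$ of first-order sentences of the language with equality and a single binary operation symbol $+$ such that, for every finite structure $\langle A,+\rangle$ with a binary operation $+$, all members of $\Phi$ hold in $\langle A,+\rangle$ if and only if $\langle A,+\rangle$ is a simple group. That is, the class of finite simple groups is not finitely axiomatizable modulo finiteness.
   Context: Groups are regarded as structures $\langle A,+\rangle$ with one binary operation. A class of finite structures is finitely axiomatizable modulo finiteness if there is a finite set of first-order sentences such that a finite structure belongs to the class if and only if it satisfies all these sentences. -}

module Defs where

open import Data.Nat using (ℕ; suc)
open import Data.Fin using (Fin; zero; suc)
open import Data.Fin.Subset using (Subset; _∈_; ⁅_⁆) renaming (⊤ to Full)
open import Data.Vec using (Vec; []; _∷_; lookup)
open import Data.Product using (Σ; _×_; ∃)
open import Data.Sum using (_⊎_)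
open import Data.Empty using (⊥)
open import Data.Unit using (⊤)
open import Relation.Binary.PropositionalEquality using (_≡_; _≢_)
open import Algebra.Structures using (IsGroup)

-- First-order logic with equality in the language {+} (one binary
-- operation symbol).  Variables are de Bruijn indices: a term / formula
-- with index k has at most k free variables.

data Term (k : ℕ) : Set where
  var  : Fin k → Term k
  _⊕_  : Term k → Term k → Term k

data Formula : ℕ → Set where
  _≐_  : ∀ {k} → Term k → Term k → Formula k
  falsum : ∀ {k} → Formula k
  _⇒_  : ∀ {k} → Formula k → Formula k → Formula k
  _∧'_ : ∀ {k} → Formula k → Formula k → Formula k
  _∨'_ : ∀ {k} → Formula k → Formula k → Formula k
  all' : ∀ {k} → Formula (suc k) → Formula k
  ex'  : ∀ {k} → Formula (suc k) → Formula k

Sentence : Set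
Sentence = Formula 0

-- Finite structures ⟨A,+⟩: the carrier is Fin n, the operation a
-- binary function on it.

Op : ℕ → Set
Op n = Fin n → Fin n → Fin n

evalT : ∀ {n k} → Op n → Vec (Fin n) k → Term k → Fin n
evalT op ρ (var i) = lookup ρ i
evalT op ρ (s ⊕ t) = op (evalT op ρ s) (evalT op ρ t)

-- Tarskian satisfaction (the carrier is finite with decidable equality,
-- so this agrees with the classical notion).
Sat : ∀ {n k} → Op n → Vec (Fin n) k → Formula k → Set
Sat op ρ (s ≐ t)  = evalT op ρ s ≡ evalT op ρ t
Sat op ρ falsum   = ⊥
Sat op ρ (φ ⇒ ψ)  = Sat op ρ φ → Sat op ρ ψ
Sat op ρ (φ ∧' ψ) = Sat op ρ φ × Sat op ρ ψ
Sat op ρ (φ ∨' ψ) = Sat op ρ φ ⊎ Sat op ρ ψ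
Sat op ρ (all' φ) = (a : _) → Sat op (a ∷ ρ) φ
Sat op ρ (ex' φ)  = Σ _ λ a → Sat op (a ∷ ρ) φ

_⊨_ : ∀ {n} → Op n → Sentence → Set
op ⊨ φ = Sat op [] φ

module _ {n : ℕ} (op : Op n) (e : Fin n) (inv : Fin n → Fin n) where

  record IsNormalSubgroup (N : Subset n) : Set where
    field
      ident∈   : e ∈ N
      op-closed  : ∀ {x y} → x ∈ N → y ∈ N → op x y ∈ N
      inv-closed : ∀ {x} → x ∈ N → inv x ∈ N
      conj-closed : ∀ g {x} → x ∈ N → op (op g x) (inv g) ∈ N

IsSimpleGroup : ∀ {n} → Op n → Set
IsSimpleGroup {n} op =
  Σ (Fin n) λ e → Σ (Fin n → Fin n) λ inv →
    IsGroup _≡_ op e inv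
    × (∃ λ x → x ≢ e)
    × (∀ (N : Subset n) → IsNormalSubgroup op e inv N → (N ≡ ⁅ e ⁆) ⊎ (N ≡ Full))

-- Were the finite simple groups axiomatized modulo finiteness by a finite Φ, then Φ would hold in
-- ℤ/p for every prime p. In ℤ/N an equation between terms of the operation says that an integer
-- linear form in the variables vanishes modulo N, with coefficients bounded by the size of the
-- terms. If every nonzero integer of absolute value at most T is invertible modulo m and modulo n,
-- and T < m, n, then a back-and-forth argument over tuples satisfying the same bounded linear
-- relations shows that ℤ/m and ℤ/n satisfy the same sentences of complexity at most T. For a prime
-- p above the complexities of the members of Φ this applies to ℤ/p and ℤ/p², so ℤ/p² ⊨ Φ although
-- ℤ/p² is not simple.

module Submission where

open import Defs
open import Algebra.Bundles using (Group)
open import Algebra.Structures using (IsGroup)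
import Algebra.Properties.Group as GroupProperties
open import Data.Empty using (⊥-elim)
open import Data.Fin as Fin using (Fin; toℕ; fromℕ<)
import Data.Fin.Properties as Finₚ
open import Data.Fin.Subset using (Subset; _∈_; ⁅_⁆) renaming (⊤ to Full)
open import Data.Fin.Subset.Properties using (_∈?_; ⊆-antisym; ⊆⊤; ∈⊤; x∈⁅x⁆; x∈⁅y⁆⇒x≡y)
open import Data.Integer as ℤ using (ℤ; +_; +[1+_]; -[1+_]; _+_; _*_; -_; _-_; ∣_∣; 0ℤ; 1ℤ)
import Data.Integer.Properties as ℤₚ
open import Data.Integer.DivMod using (_%ℕ_; _/ℕ_; n%ℕd<d; a≡a%ℕn+[a/ℕn]*n)
open import Data.Integer.Divisibility.Signed as ℤᵈ using (_∣_; divides; _∣?_)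
open import Data.Integer.Tactic.RingSolver using (solve-∀)
open import Data.List as List using (List; []; _∷_; length; cartesianProductWith)
open import Data.List.Extrema.Nat using (max; xs≤max)
open import Data.List.Membership.Propositional using (lose; find) renaming (_∈_ to _∈ₗ_)
open import Data.List.Membership.Propositional.Properties
  using (∈-lookup; ∈-cartesianProductWith⁺; ∈-cartesianProductWith⁻)
open import Data.List.Relation.Unary.All as All using (All; _∷_)
open import Data.List.Relation.Unary.All.Properties using (map⁻)
open import Data.List.Relation.Unary.Any as Any using (Any; here; there)
open import Data.List.Relation.Unary.Any.Properties using (lookup-index)
open import Data.Nat as ℕ using (ℕ; zero; suc; NonZero; _≤_; _<_; _!)
import Data.Nat.Properties as ℕₚ
import Data.Nat.Coprimality as Coprimality
open import Data.Nat.Coprimality using (Coprime; coprime-Bézout; coprime-divisor; prime⇒coprime)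
import Data.Nat.Divisibility as ℕᵈ
open import Data.Nat.GCD using (module Bézout)
open import Data.Nat.Primality using (Prime; prime⇒nonZero; prime⇒nonTrivial)
open import Data.Nat.Primality.Factorisation using (factorise)
open import Data.Product using (Σ; ∃; _×_; _,_)
open import Data.Product.Function.NonDependent.Propositional using (_×-⇔_)
open import Data.Sum using (_⊎_; inj₁; inj₂)
open import Data.Sum.Function.Propositional using (_⊎-⇔_)
open import Data.Vec as Vec using (Vec; []; _∷_; zipWith; replicate; lookup; tabulate)
open import Data.Vec.Properties using (lookup-map; lookup∘tabulate; []=⇒lookup; lookup⇒[]=)
open import Data.Vec.Relation.Unary.All as AllV using ([]; _∷_) renaming (All to AllV)
open import Function.Bundles using (_⇔_; mk⇔; Equivalence)
open import Function.Properties.Equivalence using (⇔-setoid) renaming (refl to ⇔-refl; sym to ⇔-sym)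
open import Function.Related.TypeIsomorphisms using (→-cong-⇔)
open import Level using (0ℓ)
open import Relation.Binary.Bundles using (Setoid)
open import Relation.Binary.PropositionalEquality
open import Relation.Binary.Structures using (IsEquivalence)
import Relation.Binary.Reasoning.Setoid as SetoidReasoning
open import Relation.Nullary using (¬_; Dec; yes; no; does; proof; contradiction; ¬?; _×-dec_)
open import Relation.Nullary.Decidable using (decidable-stable; dec-true; map′)
open import Relation.Nullary.Reflects using (Reflects; invert)

private variable k : ℕ

infix 4 _≡_[mod_]
record _≡_[mod_] (x y : ℤ) (N : ℕ) : Set where
  constructor mod-divides
  field divides-difference : + N ∣ x - y
open _≡_[mod_] public

module _ {N : ℕ} where

  ≡-mod-via : ∀ {x y z} → x - y ≡ z → + N ∣ z → x ≡ y [mod N ]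
  ≡-mod-via refl N∣z = mod-divides N∣z

  ≡-mod-refl : ∀ {x} → x ≡ x [mod N ]
  ≡-mod-refl {x} = ≡-mod-via (ℤₚ.+-inverseʳ x) (divides 0ℤ refl)

  ≡-mod-reflexive : ∀ {x y} → x ≡ y → x ≡ y [mod N ]
  ≡-mod-reflexive refl = ≡-mod-refl

  ≡-mod-sym : ∀ {x y} → x ≡ y [mod N ] → y ≡ x [mod N ]
  ≡-mod-sym {x} {y} (mod-divides d) = ≡-mod-via (swap x y) (ℤᵈ.∣m⇒∣-m d)
    where swap : ∀ x y → y - x ≡ - (x - y)
          swap = solve-∀

  ≡-mod-trans : ∀ {x y z} → x ≡ y [mod N ] → y ≡ z [mod N ] → x ≡ z [mod N ]
  ≡-mod-trans {x} {y} {z} (mod-divides d) (mod-divides e) = ≡-mod-via (split x y z) (ℤᵈ.∣m∣n⇒∣m+n d e)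
    where split : ∀ x y z → x - z ≡ (x - y) + (y - z)
          split = solve-∀

  ≡-mod-isEquivalence : IsEquivalence (λ x y → x ≡ y [mod N ])
  ≡-mod-isEquivalence = record { refl = ≡-mod-refl ; sym = ≡-mod-sym ; trans = ≡-mod-trans }

  +-cong-mod : ∀ {x x′ y y′} → x ≡ x′ [mod N ] → y ≡ y′ [mod N ] → x + y ≡ x′ + y′ [mod N ]
  +-cong-mod {x} {x′} {y} {y′} (mod-divides d) (mod-divides e) = ≡-mod-via (regroup x x′ y y′) (ℤᵈ.∣m∣n⇒∣m+n d e)
    where regroup : ∀ x x′ y y′ → (x + y) - (x′ + y′) ≡ (x - x′) + (y - y′)
          regroup = solve-∀

  +-congˡ-mod : ∀ k {y y′} → y ≡ y′ [mod N ] → k + y ≡ k + y′ [mod N ]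
  +-congˡ-mod k = +-cong-mod (≡-mod-refl {k})

  +-congʳ-mod : ∀ k {x x′} → x ≡ x′ [mod N ] → x + k ≡ x′ + k [mod N ]
  +-congʳ-mod k x≡x′ = +-cong-mod x≡x′ ≡-mod-refl

  *-congˡ-mod : ∀ k {x x′} → x ≡ x′ [mod N ] → k * x ≡ k * x′ [mod N ]
  *-congˡ-mod k {x} {x′} (mod-divides d) = ≡-mod-via (factor k x x′) (ℤᵈ.∣n⇒∣m*n k d)
    where factor : ∀ k x x′ → k * x - k * x′ ≡ k * (x - x′)
          factor = solve-∀

  *-congʳ-mod : ∀ k {x x′} → x ≡ x′ [mod N ] → x * k ≡ x′ * k [mod N ]
  *-congʳ-mod k {x} {x′} (mod-divides d) = ≡-mod-via (factor k x x′) (ℤᵈ.∣n⇒∣m*n k d)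
    where factor : ∀ k x x′ → x * k - x′ * k ≡ k * (x - x′)
          factor = solve-∀

  neg-cong-mod : ∀ {x x′} → x ≡ x′ [mod N ] → - x ≡ - x′ [mod N ]
  neg-cong-mod {x} {x′} (mod-divides d) = ≡-mod-via (factor x x′) (ℤᵈ.∣m⇒∣-m d)
    where factor : ∀ x x′ → - x - - x′ ≡ - (x - x′)
          factor = solve-∀

  +-multiple-mod : ∀ x q → x + q * + N ≡ x [mod N ]
  +-multiple-mod x q = ≡-mod-via (cancel x q (+ N)) (ℤᵈ.∣n⇒∣m*n q ℤᵈ.∣-refl)
    where cancel : ∀ x q n → x + q * n - x ≡ q * n
          cancel = solve-∀

≡-mod-setoid : ℕ → Setoid _ _
≡-mod-setoid N = record { isEquivalence = ≡-mod-isEquivalence {N} }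

module ≡-mod-Reasoning (N : ℕ) = SetoidReasoning (≡-mod-setoid N)

module ⇔-Reasoning = SetoidReasoning (⇔-setoid 0ℓ)

≡-mod-⇔ : ∀ {N x x′ y y′} → x ≡ x′ [mod N ] → y ≡ y′ [mod N ] → (x ≡ y [mod N ]) ⇔ (x′ ≡ y′ [mod N ])
≡-mod-⇔ x≡x′ y≡y′ = mk⇔ (λ x≡y → ≡-mod-trans (≡-mod-sym x≡x′) (≡-mod-trans x≡y y≡y′))
                        (λ x′≡y′ → ≡-mod-trans x≡x′ (≡-mod-trans x′≡y′ (≡-mod-sym y≡y′)))

≡-mod⇔-≡0 : ∀ {N} x y → (x ≡ y [mod N ]) ⇔ (x - y ≡ 0ℤ [mod N ])
≡-mod⇔-≡0 {N} x y = mk⇔ (λ (mod-divides d) → mod-divides (subst (+ N ∣_) (sym (ℤₚ.+-identityʳ _)) d))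
                        (λ (mod-divides d) → mod-divides (subst (+ N ∣_) (ℤₚ.+-identityʳ _) d))

infix 4 _≡?_[mod_]
_≡?_[mod_] : ∀ x y N → Dec (x ≡ y [mod N ])
x ≡? y [mod N ] = map′ mod-divides divides-difference (+ N ∣? (x - y))

-- ℤ/N on Fin N

toℤ : ∀ {N} → Fin N → ℤ
toℤ x = + toℕ x

multiple-below-modulus≡0 : ∀ {N z} → + N ∣ z → ∣ z ∣ < N → z ≡ 0ℤ
multiple-below-modulus≡0 {z = + zero}   _   _   = refl
multiple-below-modulus≡0 {z = +[1+ _ ]} N∣z z<N = contradiction (ℤᵈ.∣⇒∣ᵤ N∣z) (ℕᵈ.>⇒∤ z<N)
multiple-below-modulus≡0 {z = -[1+ _ ]} N∣z z<N = contradiction (ℤᵈ.∣⇒∣ᵤ N∣z) (ℕᵈ.>⇒∤ z<N)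

∣toℤ-toℤ∣<N : ∀ {N} (x y : Fin N) → ∣ toℤ x - toℤ y ∣ < N
∣toℤ-toℤ∣<N x y = begin-strict
  ∣ + toℕ x - + toℕ y ∣ ≡⟨ cong ∣_∣ (ℤₚ.m-n≡m⊖n (toℕ x) (toℕ y)) ⟩
  ∣ toℕ x ℤ.⊖ toℕ y ∣   ≤⟨ ℤₚ.∣m⊝n∣≤m⊔n (toℕ x) (toℕ y) ⟩
  toℕ x ℕ.⊔ toℕ y       <⟨ ℕₚ.⊔-lub (Finₚ.toℕ<n x) (Finₚ.toℕ<n y) ⟩
  _                     ∎
  where open ℕₚ.≤-Reasoning

≡-mod⇒≡ : ∀ {N} {x y : Fin N} → toℤ x ≡ toℤ y [mod N ] → x ≡ y
≡-mod⇒≡ {x = x} {y} (mod-divides N∣x-y) =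
  Finₚ.toℕ-injective (ℤₚ.+-injective (ℤₚ.i-j≡0⇒i≡j _ _
    (multiple-below-modulus≡0 N∣x-y (∣toℤ-toℤ∣<N x y))))

module _ {N : ℕ} .{{_ : NonZero N}} where

  -- Opaque: unfolding the remainder computation during unification makes typechecking blow up.
  opaque
    fromℤ : ℤ → Fin N
    fromℤ z = fromℕ< (n%ℕd<d z N)

    toℤ-fromℤ : ∀ z → toℤ (fromℤ z) ≡ z [mod N ]
    toℤ-fromℤ z = begin
      toℤ (fromℤ z)               ≡⟨ cong +_ (Finₚ.toℕ-fromℕ< (n%ℕd<d z N)) ⟩
      + (z %ℕ N)                  ≈⟨ +-multiple-mod _ (z /ℕ N) ⟨
      + (z %ℕ N) + z /ℕ N * + N   ≡⟨ a≡a%ℕn+[a/ℕn]*n z N ⟨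
      z                           ∎
      where open ≡-mod-Reasoning N

  fromℤ-cong : ∀ {z z′} → z ≡ z′ [mod N ] → fromℤ z ≡ fromℤ z′
  fromℤ-cong z≡z′ = ≡-mod⇒≡ (≡-mod-trans (toℤ-fromℤ _) (≡-mod-trans z≡z′ (≡-mod-sym (toℤ-fromℤ _))))

  fromℤ-toℤ : ∀ x → fromℤ (toℤ x) ≡ x
  fromℤ-toℤ x = ≡-mod⇒≡ (toℤ-fromℤ (toℤ x))

  ≡⇔toℤ-≡-mod : {x y : Fin N} → (x ≡ y) ⇔ (toℤ x ≡ toℤ y [mod N ])
  ≡⇔toℤ-≡-mod = mk⇔ (λ x≡y → ≡-mod-reflexive (cong toℤ x≡y)) ≡-mod⇒≡

  infixl 6 _+ₘ_
  _+ₘ_ : Fin N → Fin N → Fin N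
  x +ₘ y = fromℤ (toℤ x + toℤ y)

  0ₘ : Fin N
  0ₘ = fromℤ 0ℤ

  -ₘ_ : Fin N → Fin N
  -ₘ x = fromℤ (- toℤ x)

  toℤ-+ₘ : ∀ x y → toℤ (x +ₘ y) ≡ toℤ x + toℤ y [mod N ]
  toℤ-+ₘ x y = toℤ-fromℤ _

  toℤ-0ₘ : toℤ 0ₘ ≡ 0ℤ [mod N ]
  toℤ-0ₘ = toℤ-fromℤ _

  toℤ-negₘ : ∀ x → toℤ (-ₘ x) ≡ - toℤ x [mod N ]
  toℤ-negₘ x = toℤ-fromℤ _

  fromℤ-injective-mod : ∀ {z z′} → fromℤ z ≡ fromℤ z′ → z ≡ z′ [mod N ]
  fromℤ-injective-mod {z} {z′} eq =
    ≡-mod-trans (≡-mod-sym (toℤ-fromℤ z)) (≡-mod-trans (≡-mod-reflexive (cong toℤ eq)) (toℤ-fromℤ z′))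

  fromℤ-small≢0ₘ : ∀ k → .{{NonZero k}} → k < N → fromℤ (+ k) ≢ 0ₘ
  fromℤ-small≢0ₘ (suc j) k<N k≡0 with fromℤ-injective-mod k≡0
  ... | mod-divides N∣k-0 =
    contradiction (multiple-below-modulus≡0 (subst (+ N ∣_) (ℤₚ.+-identityʳ (+ suc j)) N∣k-0) k<N) λ ()

  toℤ≢0 : ∀ {x : Fin N} → x ≢ 0ₘ → toℤ x ≢ 0ℤ
  toℤ≢0 x≢0 tx≡0 = x≢0 (≡-mod⇒≡ (≡-mod-trans (≡-mod-reflexive tx≡0) (≡-mod-sym toℤ-0ₘ)))

  open ≡-mod-Reasoning N

  +ₘ-assoc : ∀ x y z → (x +ₘ y) +ₘ z ≡ x +ₘ (y +ₘ z)
  +ₘ-assoc x y z = ≡-mod⇒≡ (begin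
    toℤ (x +ₘ y +ₘ z)           ≈⟨ toℤ-+ₘ (x +ₘ y) z ⟩
    toℤ (x +ₘ y) + toℤ z        ≈⟨ +-congʳ-mod (toℤ z) (toℤ-+ₘ x y) ⟩
    toℤ x + toℤ y + toℤ z       ≡⟨ ℤₚ.+-assoc (toℤ x) (toℤ y) (toℤ z) ⟩
    toℤ x + (toℤ y + toℤ z)     ≈⟨ +-congˡ-mod (toℤ x) (toℤ-+ₘ y z) ⟨
    toℤ x + toℤ (y +ₘ z)        ≈⟨ toℤ-+ₘ x (y +ₘ z) ⟨
    toℤ (x +ₘ (y +ₘ z))         ∎)

  +ₘ-identityˡ : ∀ x → 0ₘ +ₘ x ≡ x
  +ₘ-identityˡ x = ≡-mod⇒≡ (begin
    toℤ (0ₘ +ₘ x)    ≈⟨ toℤ-+ₘ 0ₘ x ⟩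
    toℤ 0ₘ + toℤ x   ≈⟨ +-congʳ-mod (toℤ x) toℤ-0ₘ ⟩
    0ℤ + toℤ x       ≡⟨ ℤₚ.+-identityˡ (toℤ x) ⟩
    toℤ x            ∎)

  +ₘ-identityʳ : ∀ x → x +ₘ 0ₘ ≡ x
  +ₘ-identityʳ x = ≡-mod⇒≡ (begin
    toℤ (x +ₘ 0ₘ)    ≈⟨ toℤ-+ₘ x 0ₘ ⟩
    toℤ x + toℤ 0ₘ   ≈⟨ +-congˡ-mod (toℤ x) toℤ-0ₘ ⟩
    toℤ x + 0ℤ       ≡⟨ ℤₚ.+-identityʳ (toℤ x) ⟩
    toℤ x            ∎)

  +ₘ-inverseˡ : ∀ x → -ₘ x +ₘ x ≡ 0ₘ
  +ₘ-inverseˡ x = ≡-mod⇒≡ (begin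
    toℤ (-ₘ x +ₘ x)      ≈⟨ toℤ-+ₘ (-ₘ x) x ⟩
    toℤ (-ₘ x) + toℤ x   ≈⟨ +-congʳ-mod (toℤ x) (toℤ-negₘ x) ⟩
    - toℤ x + toℤ x      ≡⟨ ℤₚ.+-inverseˡ (toℤ x) ⟩
    0ℤ                   ≈⟨ toℤ-0ₘ ⟨
    toℤ 0ₘ               ∎)

  +ₘ-inverseʳ : ∀ x → x +ₘ -ₘ x ≡ 0ₘ
  +ₘ-inverseʳ x = ≡-mod⇒≡ (begin
    toℤ (x +ₘ -ₘ x)      ≈⟨ toℤ-+ₘ x (-ₘ x) ⟩
    toℤ x + toℤ (-ₘ x)   ≈⟨ +-congˡ-mod (toℤ x) (toℤ-negₘ x) ⟩
    toℤ x - toℤ x        ≡⟨ ℤₚ.+-inverseʳ (toℤ x) ⟩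
    0ℤ                   ≈⟨ toℤ-0ₘ ⟨
    toℤ 0ₘ               ∎)

  +ₘ-conj : ∀ g x → g +ₘ x +ₘ -ₘ g ≡ x
  +ₘ-conj g x = ≡-mod⇒≡ (begin
    toℤ (g +ₘ x +ₘ -ₘ g)             ≈⟨ toℤ-+ₘ (g +ₘ x) (-ₘ g) ⟩
    toℤ (g +ₘ x) + toℤ (-ₘ g)        ≈⟨ +-cong-mod (toℤ-+ₘ g x) (toℤ-negₘ g) ⟩
    toℤ g + toℤ x + - toℤ g          ≡⟨ cancel (toℤ g) (toℤ x) ⟩
    toℤ x                            ∎)
    where cancel : ∀ g x → g + x + - g ≡ x
          cancel = solve-∀

  +ₘ-isGroup : IsGroup _≡_ _+ₘ_ 0ₘ -ₘ_
  +ₘ-isGroup = record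
    { isMonoid = record
      { isSemigroup = record
        { isMagma = record { isEquivalence = isEquivalence ; ∙-cong = cong₂ _+ₘ_ }
        ; assoc   = +ₘ-assoc
        }
      ; identity = +ₘ-identityˡ , +ₘ-identityʳ
      }
    ; inverse = +ₘ-inverseˡ , +ₘ-inverseʳ
    ; ⁻¹-cong = cong -ₘ_
    }

infix 25 ℤ/_
ℤ/_ : ∀ N .{{_ : NonZero N}} → Op N
ℤ/ N = _+ₘ_

-- Terms as linear forms

basis : Fin k → Vec ℤ k
basis Fin.zero    = 1ℤ ∷ replicate _ 0ℤ
basis (Fin.suc i) = 0ℤ ∷ basis i

coefficients : Term k → Vec ℤ k
coefficients (var i) = basis i
coefficients (s ⊕ t) = zipWith _+_ (coefficients s) (coefficients t)

size : Term k → ℕ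
size (var i) = 1
size (s ⊕ t) = size s ℕ.+ size t

infixl 7 _·_
_·_ : Vec ℤ k → Vec ℤ k → ℤ
[]       · []       = 0ℤ
(c ∷ cs) · (x ∷ xs) = c * x + cs · xs

combination : ℤ → Vec ℤ k → ℤ → Vec ℤ k → Vec ℤ k
combination c u c′ v = zipWith (λ p q → c * p - c′ * q) u v

replicate-0-· : ∀ (xs : Vec ℤ k) → replicate k 0ℤ · xs ≡ 0ℤ
replicate-0-· []       = refl
replicate-0-· (x ∷ xs) = cong (λ r → 0ℤ * x + r) (replicate-0-· xs)

basis-· : ∀ (i : Fin k) xs → basis i · xs ≡ lookup xs i
basis-· Fin.zero    (x ∷ xs) = begin
  1ℤ * x + replicate _ 0ℤ · xs  ≡⟨ cong₂ _+_ (ℤₚ.*-identityˡ x) (replicate-0-· xs) ⟩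
  x + 0ℤ                        ≡⟨ ℤₚ.+-identityʳ x ⟩
  x                             ∎
  where open ≡-Reasoning
basis-· (Fin.suc i) (x ∷ xs) = trans (ℤₚ.+-identityˡ (basis i · xs)) (basis-· i xs)

zipWith-+-· : ∀ (u v xs : Vec ℤ k) → zipWith _+_ u v · xs ≡ u · xs + v · xs
zipWith-+-· []      []      []       = refl
zipWith-+-· (p ∷ u) (q ∷ v) (x ∷ xs) = begin
  (p + q) * x + zipWith _+_ u v · xs    ≡⟨ cong (λ r → (p + q) * x + r) (zipWith-+-· u v xs) ⟩
  (p + q) * x + (u · xs + v · xs)       ≡⟨ regroup p q x (u · xs) (v · xs) ⟩
  (p * x + u · xs) + (q * x + v · xs)   ∎
  where open ≡-Reasoning
        regroup : ∀ p q x U V → (p + q) * x + (U + V) ≡ (p * x + U) + (q * x + V)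
        regroup = solve-∀

zipWith-minus-· : ∀ (u v xs : Vec ℤ k) → zipWith _-_ u v · xs ≡ u · xs - v · xs
zipWith-minus-· []      []      []       = refl
zipWith-minus-· (p ∷ u) (q ∷ v) (x ∷ xs) = begin
  (p - q) * x + zipWith _-_ u v · xs    ≡⟨ cong (λ r → (p - q) * x + r) (zipWith-minus-· u v xs) ⟩
  (p - q) * x + (u · xs - v · xs)       ≡⟨ regroup p q x (u · xs) (v · xs) ⟩
  (p * x + u · xs) - (q * x + v · xs)   ∎
  where open ≡-Reasoning
        regroup : ∀ p q x U V → (p - q) * x + (U - V) ≡ (p * x + U) - (q * x + V)
        regroup = solve-∀

combination-· : ∀ c c′ (u v xs : Vec ℤ k) → combination c u c′ v · xs ≡ c * (u · xs) - c′ * (v · xs)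
combination-· c c′ []      []      []       = sym (vanish c c′)
  where vanish : ∀ c c′ → c * 0ℤ - c′ * 0ℤ ≡ 0ℤ
        vanish = solve-∀
combination-· c c′ (p ∷ u) (q ∷ v) (x ∷ xs) = begin
  (c * p - c′ * q) * x + combination c u c′ v · xs          ≡⟨ cong (λ r → (c * p - c′ * q) * x + r) (combination-· c c′ u v xs) ⟩
  (c * p - c′ * q) * x + (c * (u · xs) - c′ * (v · xs))     ≡⟨ regroup c c′ p q x (u · xs) (v · xs) ⟩
  c * (p * x + u · xs) - c′ * (q * x + v · xs)              ∎
  where open ≡-Reasoning
        regroup : ∀ c c′ p q x U V →
                  (c * p - c′ * q) * x + (c * U - c′ * V) ≡ c * (p * x + U) - c′ * (q * x + V)
        regroup = solve-∀

Bounded : ℕ → Vec ℤ k → Set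
Bounded B = AllV (λ c → ∣ c ∣ ≤ B)

Bounded-mono : ∀ {B B′} {v : Vec ℤ k} → B ≤ B′ → Bounded B v → Bounded B′ v
Bounded-mono B≤B′ = AllV.map (λ c≤B → ℕₚ.≤-trans c≤B B≤B′)

replicate-0-bounded : ∀ {B} k → Bounded B (replicate k 0ℤ)
replicate-0-bounded zero    = []
replicate-0-bounded (suc k) = ℕ.z≤n ∷ replicate-0-bounded k

basis-bounded : (i : Fin k) → Bounded 1 (basis i)
basis-bounded Fin.zero    = ℕₚ.≤-refl ∷ replicate-0-bounded _
basis-bounded (Fin.suc i) = ℕ.z≤n ∷ basis-bounded i

zipWith-bounded : ∀ {A B} (f : ℤ → ℤ → ℤ) → (∀ x y → ∣ f x y ∣ ≤ ∣ x ∣ ℕ.+ ∣ y ∣) →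
                  {u v : Vec ℤ k} → Bounded A u → Bounded B v → Bounded (A ℕ.+ B) (zipWith f u v)
zipWith-bounded f f-bound []          []          = []
zipWith-bounded f f-bound (p≤A ∷ u≤A) (q≤B ∷ v≤B) =
  ℕₚ.≤-trans (f-bound _ _) (ℕₚ.+-mono-≤ p≤A q≤B) ∷ zipWith-bounded f f-bound u≤A v≤B

coefficients-bounded : (t : Term k) → Bounded (size t) (coefficients t)
coefficients-bounded (var i) = basis-bounded i
coefficients-bounded (s ⊕ t) =
  zipWith-bounded _+_ ℤₚ.∣i+j∣≤∣i∣+∣j∣ (coefficients-bounded s) (coefficients-bounded t)

∣i*j∣≤B*B : ∀ {B} i j → ∣ i ∣ ≤ B → ∣ j ∣ ≤ B → ∣ i * j ∣ ≤ B ℕ.* B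
∣i*j∣≤B*B i j i≤B j≤B = ℕₚ.≤-trans (ℕₚ.≤-reflexive (ℤₚ.∣i*j∣≡∣i∣*∣j∣ i j)) (ℕₚ.*-mono-≤ i≤B j≤B)

combination-bounded : ∀ {B} c c′ {u v : Vec ℤ k} → ∣ c ∣ ≤ B → ∣ c′ ∣ ≤ B →
                      Bounded B u → Bounded B v → Bounded (B ℕ.* B ℕ.+ B ℕ.* B) (combination c u c′ v)
combination-bounded c c′ c≤B c′≤B []          []          = []
combination-bounded c c′ {p ∷ _} {q ∷ _} c≤B c′≤B (p≤B ∷ u≤B) (q≤B ∷ v≤B) =
  ℕₚ.≤-trans (ℤₚ.∣i-j∣≤∣i∣+∣j∣ (c * p) (c′ * q))
             (ℕₚ.+-mono-≤ (∣i*j∣≤B*B c p c≤B p≤B) (∣i*j∣≤B*B c′ q c′≤B q≤B))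
  ∷ combination-bounded c c′ c≤B c′≤B u≤B v≤B

toℤs : ∀ {N} → Vec (Fin N) k → Vec ℤ k
toℤs = Vec.map toℤ

module _ {N : ℕ} .{{_ : NonZero N}} where

  toℤ-evalT : ∀ (ρ : Vec (Fin N) k) t → toℤ (evalT (ℤ/ N) ρ t) ≡ coefficients t · toℤs ρ [mod N ]
  toℤ-evalT ρ (var i) = ≡-mod-reflexive (sym (trans (basis-· i (toℤs ρ)) (lookup-map i toℤ ρ)))
  toℤ-evalT ρ (s ⊕ t) = begin
    toℤ (evalT (ℤ/ N) ρ s +ₘ evalT (ℤ/ N) ρ t)               ≈⟨ toℤ-+ₘ (evalT (ℤ/ N) ρ s) (evalT (ℤ/ N) ρ t) ⟩
    toℤ (evalT (ℤ/ N) ρ s) + toℤ (evalT (ℤ/ N) ρ t)          ≈⟨ +-cong-mod (toℤ-evalT ρ s) (toℤ-evalT ρ t) ⟩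
    coefficients s · toℤs ρ + coefficients t · toℤs ρ       ≡⟨ zipWith-+-· (coefficients s) (coefficients t) (toℤs ρ) ⟨
    coefficients (s ⊕ t) · toℤs ρ                           ∎
    where open ≡-mod-Reasoning N

  evalT-≡⇔ : ∀ (ρ : Vec (Fin N) k) s t →
             (evalT (ℤ/ N) ρ s ≡ evalT (ℤ/ N) ρ t) ⇔
             (zipWith _-_ (coefficients s) (coefficients t) · toℤs ρ ≡ 0ℤ [mod N ])
  evalT-≡⇔ ρ s t = begin
    (evalT (ℤ/ N) ρ s ≡ evalT (ℤ/ N) ρ t)                        ≈⟨ ≡⇔toℤ-≡-mod ⟩
    (toℤ (evalT (ℤ/ N) ρ s) ≡ toℤ (evalT (ℤ/ N) ρ t) [mod N ])   ≈⟨ ≡-mod-⇔ (toℤ-evalT ρ s) (toℤ-evalT ρ t) ⟩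
    (cs · xs ≡ ct · xs [mod N ])                                 ≈⟨ ≡-mod⇔-≡0 (cs · xs) (ct · xs) ⟩
    (cs · xs - ct · xs ≡ 0ℤ [mod N ])                            ≡⟨ cong (_≡ 0ℤ [mod N ]) (zipWith-minus-· cs ct xs) ⟨
    (zipWith _-_ cs ct · xs ≡ 0ℤ [mod N ])                       ∎
    where open ⇔-Reasoning
          cs = coefficients s
          ct = coefficients t
          xs = toℤs ρ

SmallUnits : ℕ → ℕ → Set
SmallUnits N B = ∀ {c} → c ≢ 0ℤ → ∣ c ∣ ≤ B → ∃ λ u → c * u ≡ 1ℤ [mod N ]

SmallUnits-mono : ∀ {N B B′} → B ≤ B′ → SmallUnits N B′ → SmallUnits N B
SmallUnits-mono B≤B′ units c≢0 c≤B = units c≢0 (ℕₚ.≤-trans c≤B B≤B′)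

module _ {N B : ℕ} (units : SmallUnits N B) {c : ℤ} (c≢0 : c ≢ 0ℤ) (c≤B : ∣ c ∣ ≤ B) where

  open ≡-mod-Reasoning N

  *-cancelˡ-≡0 : ∀ {x} → c * x ≡ 0ℤ [mod N ] → x ≡ 0ℤ [mod N ]
  *-cancelˡ-≡0 {x} cx≡0 with units c≢0 c≤B
  ... | u , cu≡1 = begin
    x              ≡⟨ ℤₚ.*-identityʳ x ⟨
    x * 1ℤ         ≈⟨ *-congˡ-mod x cu≡1 ⟨
    x * (c * u)    ≡⟨ swap x c u ⟩
    u * (c * x)    ≈⟨ *-congˡ-mod u cx≡0 ⟩
    u * 0ℤ         ≡⟨ ℤₚ.*-zeroʳ u ⟩
    0ℤ             ∎
    where swap : ∀ x c u → x * (c * u) ≡ u * (c * x)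
          swap = solve-∀

  eliminate : ∀ {x E} → c * x + E ≡ 0ℤ [mod N ] →
              ∀ c′ E′ → (c′ * x + E′ ≡ 0ℤ [mod N ]) ⇔ (c * E′ - c′ * E ≡ 0ℤ [mod N ])
  eliminate {x} {E} cx+E≡0 c′ E′ = mk⇔ to from
    where
      to : c′ * x + E′ ≡ 0ℤ [mod N ] → c * E′ - c′ * E ≡ 0ℤ [mod N ]
      to c′x+E′≡0 = begin
        c * E′ - c′ * E                          ≡⟨ expand c c′ x E E′ ⟩
        c * (c′ * x + E′) - c′ * (c * x + E)     ≈⟨ +-cong-mod (*-congˡ-mod c c′x+E′≡0) (neg-cong-mod (*-congˡ-mod c′ cx+E≡0)) ⟩
        c * 0ℤ - c′ * 0ℤ                         ≡⟨ vanish c c′ ⟩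
        0ℤ                                       ∎
        where expand : ∀ c c′ x E E′ → c * E′ - c′ * E ≡ c * (c′ * x + E′) - c′ * (c * x + E)
              expand = solve-∀
              vanish : ∀ c c′ → c * 0ℤ - c′ * 0ℤ ≡ 0ℤ
              vanish = solve-∀
      from : c * E′ - c′ * E ≡ 0ℤ [mod N ] → c′ * x + E′ ≡ 0ℤ [mod N ]
      from eliminated = *-cancelˡ-≡0 (begin
        c * (c′ * x + E′)                        ≡⟨ expand c c′ x E E′ ⟩
        (c * E′ - c′ * E) + c′ * (c * x + E)     ≈⟨ +-cong-mod eliminated (*-congˡ-mod c′ cx+E≡0) ⟩
        0ℤ + c′ * 0ℤ                             ≡⟨ vanish c′ ⟩
        0ℤ                                       ∎)
        where expand : ∀ c c′ x E E′ → c * (c′ * x + E′) ≡ (c * E′ - c′ * E) + c′ * (c * x + E)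
              expand = solve-∀
              vanish : ∀ c′ → 0ℤ + c′ * 0ℤ ≡ 0ℤ
              vanish = solve-∀

  linear-solution-unique : ∀ {E} {x y : Fin N} →
                           c * toℤ x + E ≡ 0ℤ [mod N ] → c * toℤ y + E ≡ 0ℤ [mod N ] → x ≡ y
  linear-solution-unique {E} {x} {y} x-solves y-solves =
    ≡-mod⇒≡ (Equivalence.from (≡-mod⇔-≡0 (toℤ x) (toℤ y)) (*-cancelˡ-≡0 (begin
      c * (toℤ x - toℤ y)                   ≡⟨ expand c (toℤ x) (toℤ y) E ⟩
      (c * toℤ x + E) - (c * toℤ y + E)     ≈⟨ +-cong-mod x-solves (neg-cong-mod y-solves) ⟩
      0ℤ                                    ∎)))
    where expand : ∀ c X Y E → c * (X - Y) ≡ (c * X + E) - (c * Y + E)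
          expand = solve-∀

  linear-solution : .{{_ : NonZero N}} → ∀ E → ∃ λ (x : Fin N) → c * toℤ x + E ≡ 0ℤ [mod N ]
  linear-solution E with units c≢0 c≤B
  ... | u , cu≡1 = fromℤ (- (u * E)) , (begin
    c * toℤ (fromℤ (- (u * E))) + E   ≈⟨ +-congʳ-mod E (*-congˡ-mod c (toℤ-fromℤ _)) ⟩
    c * (- (u * E)) + E               ≡⟨ regroup c u E ⟩
    E + (- E) * (c * u)               ≈⟨ +-congˡ-mod E (*-congˡ-mod (- E) cu≡1) ⟩
    E + (- E) * 1ℤ                    ≡⟨ cancel E ⟩
    0ℤ                                ∎)
    where regroup : ∀ c u E → c * (- (u * E)) + E ≡ E + (- E) * (c * u)
          regroup = solve-∀
          cancel : ∀ E → E + (- E) * 1ℤ ≡ 0ℤ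
          cancel = solve-∀

integersUpTo : ℕ → List ℤ
integersUpTo zero    = 0ℤ ∷ []
integersUpTo (suc B) = + suc B ∷ -[1+ B ] ∷ integersUpTo B

∈-integersUpTo⁻ : ∀ B {z} → z ∈ₗ integersUpTo B → ∣ z ∣ ≤ B
∈-integersUpTo⁻ zero    (here refl)         = ℕ.z≤n
∈-integersUpTo⁻ (suc B) (here refl)         = ℕₚ.≤-refl
∈-integersUpTo⁻ (suc B) (there (here refl)) = ℕₚ.≤-refl
∈-integersUpTo⁻ (suc B) (there (there z∈))  = ℕₚ.m≤n⇒m≤1+n (∈-integersUpTo⁻ B z∈)

∈-integersUpTo⁺ : ∀ B {z} → ∣ z ∣ ≤ B → z ∈ₗ integersUpTo B
∈-integersUpTo⁺ zero    {+ zero}   _   = here refl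
∈-integersUpTo⁺ (suc B) {z} z≤1+B with ∣ z ∣ ℕ.≟ suc B
∈-integersUpTo⁺ (suc B) {+ _}      _     | yes refl = here refl
∈-integersUpTo⁺ (suc B) { -[1+ _ ]} _    | yes refl = there (here refl)
... | no z≢1+B = there (there (∈-integersUpTo⁺ B (ℕₚ.≤-pred (ℕₚ.≤∧≢⇒< z≤1+B z≢1+B))))

boundedVecs : ∀ k → ℕ → List (Vec ℤ k)
boundedVecs zero    B = [] ∷ []
boundedVecs (suc k) B = cartesianProductWith _∷_ (integersUpTo B) (boundedVecs k B)

∈-boundedVecs⁻ : ∀ k B {v} → v ∈ₗ boundedVecs k B → Bounded B v
∈-boundedVecs⁻ zero    B {[]} _ = []
∈-boundedVecs⁻ (suc k) B v∈ with ∈-cartesianProductWith⁻ _∷_ (integersUpTo B) (boundedVecs k B) v∈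
... | c , e , c∈ , e∈ , refl = ∈-integersUpTo⁻ B c∈ ∷ ∈-boundedVecs⁻ k B e∈

∈-boundedVecs⁺ : ∀ k B {v} → Bounded B v → v ∈ₗ boundedVecs k B
∈-boundedVecs⁺ zero    B []            = here refl
∈-boundedVecs⁺ (suc k) B (c≤B ∷ e≤B) =
  ∈-cartesianProductWith⁺ _∷_ (∈-integersUpTo⁺ B c≤B) (∈-boundedVecs⁺ k B e≤B)

uncovered-point : ∀ {A : Set} {n} (P : A → Fin n → Set) → (∀ a x → Dec (P a x)) →
                  (L : List A) → (∀ {a x y} → a ∈ₗ L → P a x → P a y → x ≡ y) →
                  length L < n → ∃ λ x → ¬ Any (λ a → P a x) L
uncovered-point P P? L unique |L|<n with Finₚ.any? (λ x → ¬? (Any.any? (λ a → P? a x) L))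
... | yes uncovered = uncovered
... | no  ¬uncovered =
  let (i , j , i<j , same-condition) = Finₚ.pigeonhole |L|<n (λ x → Any.index (covering x))
  in contradiction (unique (∈-lookup _) (lookup-index (covering i))
                           (subst (λ a → P a j) (cong (List.lookup L) (sym same-condition)) (lookup-index (covering j))))
                   (Finₚ.<⇒≢ i<j)
  where
    covering : ∀ x → Any (λ a → P a x) L
    covering x = decidable-stable (Any.any? (λ a → P? a x) L) (λ ¬covered → ¬uncovered (x , ¬covered))

module _ {m n : ℕ} where

  SameRelations : ℕ → Vec (Fin m) k → Vec (Fin n) k → Set
  SameRelations B a b = ∀ e → Bounded B e → (e · toℤs a ≡ 0ℤ [mod m ]) ⇔ (e · toℤs b ≡ 0ℤ [mod n ])

  SameRelations-mono : ∀ {B B′} {a : Vec (Fin m) k} {b} → B ≤ B′ → SameRelations B′ a b → SameRelations B a b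
  SameRelations-mono B≤B′ same e e≤B = same e (Bounded-mono B≤B′ e≤B)

  SameRelations-[] : ∀ B → SameRelations B [] []
  SameRelations-[] B [] [] = mk⇔ (λ _ → ≡-mod-refl) (λ _ → ≡-mod-refl)

SameRelations-sym : ∀ {m n B} {a : Vec (Fin m) k} {b : Vec (Fin n) k} → SameRelations B a b → SameRelations B b a
SameRelations-sym same e e≤B = ⇔-sym (same e e≤B)

-- The back-and-forth system

-- The coefficients of c e′ - c′ e for B-bounded c, c′, e, e′; the summand B covers c′ = 0.
eliminationBound : ℕ → ℕ
eliminationBound B = B ℕ.+ (B ℕ.* B ℕ.+ B ℕ.* B)

-- With c invertible, c x + e · ys ≡ 0 determines x from ys.
Pinning : ∀ N → Vec ℤ (suc k) → Vec ℤ (suc k) → Set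
Pinning N (c ∷ e) xs = c ≢ 0ℤ × (c ∷ e) · xs ≡ 0ℤ [mod N ]

pinning? : ∀ N (v xs : Vec ℤ (suc k)) → Dec (Pinning N v xs)
pinning? N (c ∷ e) xs = ¬? (c ℤ.≟ 0ℤ) ×-dec ((c ∷ e) · xs ≡? 0ℤ [mod N ])

-- If a bounded relation pins a′ over a, solving the same relation over b gives b′: the relations
-- c e′ - c′ e obtained by eliminating the new variable hold for a exactly when they hold for b.
-- Otherwise every nonzero-headed bounded relation fails at a′, and b′ only has to avoid the
-- fewer than n values pinned over b.
module Extension {m n B : ℕ} .{{_ : NonZero n}} (units-m : SmallUnits m B) (units-n : SmallUnits n B)
                 {a : Vec (Fin m) k} {b : Vec (Fin n) k} (same : SameRelations (eliminationBound B) a b)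
                 (a′ : Fin m) where

  private
    relations = boundedVecs (suc k) B

  extend-pinned : ∀ {c e} → Bounded B (c ∷ e) → Pinning m (c ∷ e) (toℤ a′ ∷ toℤs a) →
                  ∃ λ b′ → SameRelations B (a′ ∷ a) (b′ ∷ b)
  extend-pinned {c} {e} (c≤B ∷ e≤B) (c≢0 , a′-pinned) with linear-solution units-n c≢0 c≤B (e · toℤs b)
  ... | b′ , b′-pinned = b′ , same′
    where
      same′ : SameRelations B (a′ ∷ a) (b′ ∷ b)
      same′ (c′ ∷ e′) (c′≤B ∷ e′≤B) = begin
        (c′ * toℤ a′ + e′ · toℤs a ≡ 0ℤ [mod m ])               ≈⟨ eliminate units-m c≢0 c≤B a′-pinned c′ _ ⟩
        (c * (e′ · toℤs a) - c′ * (e · toℤs a) ≡ 0ℤ [mod m ])   ≡⟨ cong (_≡ 0ℤ [mod m ]) (combination-· c c′ e′ e (toℤs a)) ⟨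
        (combination c e′ c′ e · toℤs a ≡ 0ℤ [mod m ])          ≈⟨ same (combination c e′ c′ e) combination≤ ⟩
        (combination c e′ c′ e · toℤs b ≡ 0ℤ [mod n ])          ≡⟨ cong (_≡ 0ℤ [mod n ]) (combination-· c c′ e′ e (toℤs b)) ⟩
        (c * (e′ · toℤs b) - c′ * (e · toℤs b) ≡ 0ℤ [mod n ])   ≈⟨ eliminate units-n c≢0 c≤B b′-pinned c′ _ ⟨
        (c′ * toℤ b′ + e′ · toℤs b ≡ 0ℤ [mod n ])               ∎
        where
          open ⇔-Reasoning
          combination≤ = Bounded-mono (ℕₚ.m≤n+m _ B) (combination-bounded c c′ c≤B c′≤B e′≤B e≤B)

  pinned-unique : ∀ {v} {x y : Fin n} → v ∈ₗ relations →
                  Pinning n v (toℤ x ∷ toℤs b) → Pinning n v (toℤ y ∷ toℤs b) → x ≡ y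
  pinned-unique {c ∷ _} v∈ (c≢0 , x-pinned) (_ , y-pinned) with ∈-boundedVecs⁻ (suc k) B v∈
  ... | c≤B ∷ _ = linear-solution-unique units-n c≢0 c≤B x-pinned y-pinned

  extend-free : length relations < n → ¬ Any (λ v → Pinning m v (toℤ a′ ∷ toℤs a)) relations →
                ∃ λ b′ → SameRelations B (a′ ∷ a) (b′ ∷ b)
  extend-free few a′-free
    with uncovered-point (λ v x → Pinning n v (toℤ x ∷ toℤs b)) (λ v x → pinning? n v _) relations pinned-unique few
  ... | b′ , b′-free = b′ , same′
    where
      same′ : SameRelations B (a′ ∷ a) (b′ ∷ b)
      same′ (c′ ∷ e′) (c′≤B ∷ e′≤B) with c′ ℤ.≟ 0ℤ
      ... | yes refl = begin
        (0ℤ * toℤ a′ + e′ · toℤs a ≡ 0ℤ [mod m ])   ≡⟨ cong (_≡ 0ℤ [mod m ]) (ℤₚ.+-identityˡ _) ⟩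
        (e′ · toℤs a ≡ 0ℤ [mod m ])                 ≈⟨ same e′ (Bounded-mono (ℕₚ.m≤m+n B _) e′≤B) ⟩
        (e′ · toℤs b ≡ 0ℤ [mod n ])                 ≡⟨ cong (_≡ 0ℤ [mod n ]) (ℤₚ.+-identityˡ _) ⟨
        (0ℤ * toℤ b′ + e′ · toℤs b ≡ 0ℤ [mod n ])   ∎
        where open ⇔-Reasoning
      ... | no c′≢0 = mk⇔ (λ a′-pinned → ⊥-elim (a′-free (lose v∈ (c′≢0 , a′-pinned))))
                          (λ b′-pinned → ⊥-elim (b′-free (lose v∈ (c′≢0 , b′-pinned))))
        where v∈ = ∈-boundedVecs⁺ (suc k) B (c′≤B ∷ e′≤B)

  extend : length relations < n → ∃ λ b′ → SameRelations B (a′ ∷ a) (b′ ∷ b)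
  extend few with Any.any? (λ v → pinning? m v (toℤ a′ ∷ toℤs a)) relations
  ... | no  a′-free   = extend-free few a′-free
  ... | yes a′-pinned with find a′-pinned
  ...   | c ∷ e , v∈ , pinned = extend-pinned (∈-boundedVecs⁻ (suc k) B v∈) pinned

module _ {A B : Set} {P : A → Set} {Q : B → Set} {R : A → B → Set}
         (forth : ∀ a → ∃ (R a)) (back : ∀ b → ∃ λ a → R a b)
         (P⇔Q : ∀ {a b} → R a b → P a ⇔ Q b) where

  Π-⇔ : (∀ a → P a) ⇔ (∀ b → Q b)
  Π-⇔ = mk⇔ (λ ∀P b → let (a , r) = back b  in Equivalence.to   (P⇔Q r) (∀P a))
            (λ ∀Q a → let (b , r) = forth a in Equivalence.from (P⇔Q r) (∀Q b))

  Σ-⇔ : Σ A P ⇔ Σ B Q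
  Σ-⇔ = mk⇔ (λ (a , p) → let (b , r) = forth a in b , Equivalence.to   (P⇔Q r) p)
            (λ (b , q) → let (a , r) = back b  in a , Equivalence.from (P⇔Q r) q)

-- A quantifier over a body of complexity B must pay for one extension step: the relations up to
-- eliminationBound B have to be preserved, and the candidate relations must be fewer than the modulus.
quantifierCost : ℕ → ℕ → ℕ
quantifierCost k B = eliminationBound B ℕ.+ length (boundedVecs (suc k) B)

complexity : Formula k → ℕ
complexity (s ≐ t)      = size s ℕ.+ size t
complexity falsum       = 0
complexity (φ ⇒ ψ)      = complexity φ ℕ.+ complexity ψ
complexity (φ ∧' ψ)     = complexity φ ℕ.+ complexity ψ
complexity (φ ∨' ψ)     = complexity φ ℕ.+ complexity ψ
complexity (all' {k} φ) = quantifierCost k (complexity φ)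
complexity (ex' {k} φ)  = quantifierCost k (complexity φ)

module Transfer {m n T : ℕ} .{{_ : NonZero m}} .{{_ : NonZero n}}
                (units-m : SmallUnits m T) (units-n : SmallUnits n T) (T<m : T < m) (T<n : T < n) where

  private
    body≤T : ∀ k B → quantifierCost k B ≤ T → B ≤ T
    body≤T _ _ cost≤T = ℕₚ.m+n≤o⇒m≤o _ (ℕₚ.m+n≤o⇒m≤o _ cost≤T)

    count≤T : ∀ k B → quantifierCost k B ≤ T → length (boundedVecs (suc k) B) ≤ T
    count≤T _ _ cost≤T = ℕₚ.m+n≤o⇒n≤o _ cost≤T

  forth : ∀ {k B} {a : Vec (Fin m) k} {b : Vec (Fin n) k} → quantifierCost k B ≤ T →
          SameRelations (quantifierCost k B) a b → ∀ a′ → ∃ λ b′ → SameRelations B (a′ ∷ a) (b′ ∷ b)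
  forth {k} {B} cost≤T same a′ =
    Extension.extend (SmallUnits-mono B≤T units-m) (SmallUnits-mono B≤T units-n)
                     (SameRelations-mono (ℕₚ.m≤m+n _ _) same) a′ (ℕₚ.≤-<-trans (count≤T k B cost≤T) T<n)
    where B≤T = body≤T k B cost≤T

  back : ∀ {k B} {a : Vec (Fin m) k} {b : Vec (Fin n) k} → quantifierCost k B ≤ T →
         SameRelations (quantifierCost k B) a b → ∀ b′ → ∃ λ a′ → SameRelations B (a′ ∷ a) (b′ ∷ b)
  back {k} {B} cost≤T same b′ =
    let (a′ , same′) = Extension.extend (SmallUnits-mono B≤T units-n) (SmallUnits-mono B≤T units-m)
                         (SameRelations-mono (ℕₚ.m≤m+n _ _) (SameRelations-sym same)) b′
                         (ℕₚ.≤-<-trans (count≤T k B cost≤T) T<m)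
    in a′ , SameRelations-sym same′
    where B≤T = body≤T k B cost≤T

  transfer : ∀ {k} (φ : Formula k) → complexity φ ≤ T → {a : Vec (Fin m) k} {b : Vec (Fin n) k} →
             SameRelations (complexity φ) a b → Sat (ℤ/ m) a φ ⇔ Sat (ℤ/ n) b φ
  transferˡ : ∀ {k} (φ ψ : Formula k) → complexity φ ℕ.+ complexity ψ ≤ T → {a : Vec (Fin m) k} {b : Vec (Fin n) k} →
              SameRelations (complexity φ ℕ.+ complexity ψ) a b → Sat (ℤ/ m) a φ ⇔ Sat (ℤ/ n) b φ
  transferʳ : ∀ {k} (φ ψ : Formula k) → complexity φ ℕ.+ complexity ψ ≤ T → {a : Vec (Fin m) k} {b : Vec (Fin n) k} →
              SameRelations (complexity φ ℕ.+ complexity ψ) a b → Sat (ℤ/ m) a ψ ⇔ Sat (ℤ/ n) b ψ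

  transfer (s ≐ t) _ {a} {b} same = begin
    (evalT (ℤ/ m) a s ≡ evalT (ℤ/ m) a t)    ≈⟨ evalT-≡⇔ a s t ⟩
    (difference · toℤs a ≡ 0ℤ [mod m ])      ≈⟨ same difference difference-bounded ⟩
    (difference · toℤs b ≡ 0ℤ [mod n ])      ≈⟨ evalT-≡⇔ b s t ⟨
    (evalT (ℤ/ n) b s ≡ evalT (ℤ/ n) b t)    ∎
    where
      open ⇔-Reasoning
      difference = zipWith _-_ (coefficients s) (coefficients t)
      difference-bounded = zipWith-bounded _-_ ℤₚ.∣i-j∣≤∣i∣+∣j∣ (coefficients-bounded s) (coefficients-bounded t)
  transfer falsum   _      _    = ⇔-refl
  transfer (φ ⇒ ψ)  cost≤T same = →-cong-⇔ (transferˡ φ ψ cost≤T same) (transferʳ φ ψ cost≤T same)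
  transfer (φ ∧' ψ) cost≤T same = transferˡ φ ψ cost≤T same ×-⇔ transferʳ φ ψ cost≤T same
  transfer (φ ∨' ψ) cost≤T same = transferˡ φ ψ cost≤T same ⊎-⇔ transferʳ φ ψ cost≤T same
  transfer (all' {k} φ) cost≤T same = Π-⇔ (forth cost≤T same) (back cost≤T same) (transfer φ (body≤T k _ cost≤T))
  transfer (ex' {k} φ) cost≤T same = Σ-⇔ (forth cost≤T same) (back cost≤T same) (transfer φ (body≤T k _ cost≤T))

  transferˡ φ ψ cost≤T same = transfer φ (ℕₚ.m+n≤o⇒m≤o _ cost≤T) (SameRelations-mono (ℕₚ.m≤m+n _ _) same)
  transferʳ φ ψ cost≤T same = transfer ψ (ℕₚ.m+n≤o⇒n≤o _ cost≤T) (SameRelations-mono (ℕₚ.m≤n+m _ _) same)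

  transfer-sentence : (φ : Sentence) → complexity φ ≤ T → (ℤ/ m ⊨ φ) ⇔ (ℤ/ n ⊨ φ)
  transfer-sentence φ cost≤T = transfer φ cost≤T (SameRelations-[] _)

n∣n! : ∀ n → .{{NonZero n}} → n ℕᵈ.∣ n !
n∣n! (suc n) = ℕᵈ.m∣m*n (n !)

-- Euclid: every prime factor of T ! + 1 exceeds T.
prime> : ∀ T → ∃ λ p → Prime p × T < p
prime> T with factorise (suc (T !))
... | record { factors = [] ; isFactorisation = 1+T!≡1 } =
  contradiction (ℕₚ.suc-injective 1+T!≡1) (ℕ.≢-nonZero⁻¹ (T !) {{T ℕₚ.!≢0}})
... | record { factors = p ∷ ps ; isFactorisation = 1+T!≡p*ps ; factorsPrime = p-prime ∷ _ } =
  p , p-prime , ℕₚ.≰⇒> p≰T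
  where
    instance _ = prime⇒nonTrivial p-prime
    p∣1+T! : p ℕᵈ.∣ suc (T !)
    p∣1+T! = subst (p ℕᵈ.∣_) (sym 1+T!≡p*ps) (ℕᵈ.m∣m*n _)
    p≰T : ¬ p ≤ T
    p≰T p≤T = ℕ.nonTrivial⇒≢1 (ℕᵈ.∣1⇒≡1 (ℕᵈ.∣m+n∣m⇒∣n (subst (p ℕᵈ.∣_) (ℕₚ.+-comm 1 (T !)) p∣1+T!)
                                                  (ℕᵈ.∣-trans (n∣n! p {{ℕ.nonTrivial⇒nonZero p}}) (ℕᵈ.m≤n⇒m!∣n! p≤T))))

coprime-* : ∀ {c m n} → Coprime c m → Coprime c n → Coprime c (m ℕ.* n)
coprime-* {m = m} c⊥m c⊥n {d} (d∣c , d∣m*n) = c⊥n (d∣c , coprime-divisor d⊥m d∣m*n)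
  where d⊥m : Coprime d m
        d⊥m (e∣d , e∣m) = c⊥m (ℕᵈ.∣-trans e∣d d∣c , e∣m)

private
  pos-1+* : ∀ a b c d → 1 ℕ.+ a ℕ.* b ≡ c ℕ.* d → 1ℤ + + a * + b ≡ + c * + d
  pos-1+* a b c d eq = begin
    1ℤ + + a * + b    ≡⟨ cong (λ z → 1ℤ + z) (ℤₚ.pos-* a b) ⟨
    + (1 ℕ.+ a ℕ.* b) ≡⟨ cong +_ eq ⟩
    + (c ℕ.* d)       ≡⟨ ℤₚ.pos-* c d ⟩
    + c * + d         ∎
    where open ≡-Reasoning

coprime⇒invertible : ∀ {c N} → Coprime c N → ∃ λ u → + c * u ≡ 1ℤ [mod N ]
coprime⇒invertible {c} {N} c⊥N with coprime-Bézout c⊥N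
... | Bézout.+- x y 1+yN≡xc = + x , mod-divides (divides (+ y) (begin
  + c * + x - 1ℤ               ≡⟨ cong (_- 1ℤ) (trans (ℤₚ.*-comm (+ c) (+ x)) (sym (pos-1+* y N x c 1+yN≡xc))) ⟩
  1ℤ + + y * + N - 1ℤ          ≡⟨ cancel (+ y * + N) ⟩
  + y * + N                    ∎))
  where open ≡-Reasoning
        cancel : ∀ z → 1ℤ + z - 1ℤ ≡ z
        cancel = solve-∀
... | Bézout.-+ x y 1+xc≡yN = - + x , mod-divides (divides (- + y) (begin
  + c * - + x - 1ℤ             ≡⟨ regroup (+ c) (+ x) ⟩
  - (1ℤ + + x * + c)           ≡⟨ cong -_ (pos-1+* x c y N 1+xc≡yN) ⟩
  - (+ y * + N)                ≡⟨ ℤₚ.neg-distribˡ-* (+ y) (+ N) ⟩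
  - + y * + N                  ∎))
  where open ≡-Reasoning
        regroup : ∀ c x → c * - x - 1ℤ ≡ - (1ℤ + x * c)
        regroup = solve-∀

coprime⇒SmallUnits : ∀ {N B} → (∀ c → .{{NonZero c}} → c ≤ B → Coprime c N) → SmallUnits N B
coprime⇒SmallUnits coprime {+ zero}   0≢0 _ = contradiction refl 0≢0
coprime⇒SmallUnits coprime {+[1+ c ]} _ c≤B = coprime⇒invertible (coprime (suc c) c≤B)
coprime⇒SmallUnits coprime { -[1+ c ]} _ c≤B with coprime⇒invertible (coprime (suc c) c≤B)
... | u , cu≡1 = - u , ≡-mod-trans (≡-mod-reflexive (neg-*-neg (+[1+ c ]) u)) cu≡1
  where neg-*-neg : ∀ c u → (- c) * (- u) ≡ c * u
        neg-*-neg = solve-∀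

module _ {p} (p-prime : Prime p) {B} (B<p : B < p) where

  coprime-below-prime : ∀ c → .{{NonZero c}} → c ≤ B → Coprime c p
  coprime-below-prime c c≤B = Coprimality.sym (prime⇒coprime p-prime (ℕₚ.≤-<-trans c≤B B<p))

  prime-SmallUnits : SmallUnits p B
  prime-SmallUnits = coprime⇒SmallUnits coprime-below-prime

  prime²-SmallUnits : SmallUnits (p ℕ.* p) B
  prime²-SmallUnits = coprime⇒SmallUnits (λ c c≤B → coprime-* (coprime-below-prime c c≤B) (coprime-below-prime c c≤B))

-- Simple groups

trivial-or-full : ∀ {n} {e : Fin n} (S : Subset n) → e ∈ S → (∀ {x} → x ∈ S → x ≢ e → ∀ y → y ∈ S) →
                  S ≡ ⁅ e ⁆ ⊎ S ≡ Full
trivial-or-full {e = e} S e∈S generates with Finₚ.any? (λ x → (x ∈? S) ×-dec ¬? (x Finₚ.≟ e))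
... | yes (x , x∈S , x≢e) = inj₂ (⊆-antisym ⊆⊤ (λ {y} _ → generates x∈S x≢e y))
... | no  ∄x              = inj₁ (⊆-antisym S⊆⁅e⁆ (λ y∈⁅e⁆ → subst (_∈ S) (sym (x∈⁅y⁆⇒x≡y e y∈⁅e⁆)) e∈S))
  where S⊆⁅e⁆ : ∀ {y} → y ∈ S → y ∈ ⁅ e ⁆
        S⊆⁅e⁆ {y} y∈S with y Finₚ.≟ e
        ... | yes refl = x∈⁅x⁆ e
        ... | no  y≢e  = contradiction (y , y∈S , y≢e) ∄x

∈-tabulate-does⇔ : ∀ {n} {P : Fin n → Set} (P? : ∀ x → Dec (P x)) {x} →
                   x ∈ tabulate (λ y → does (P? y)) ⇔ P x
∈-tabulate-does⇔ P? {x} = mk⇔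
  (λ x∈ → invert (subst (Reflects _) (trans (sym (lookup∘tabulate _ x)) ([]=⇒lookup x∈)) (proof (P? x))))
  (λ Px → lookup⇒[]= x _ (trans (lookup∘tabulate _ x) (dec-true (P? x) Px)))

module _ {n} {op : Op n} {e e′ inv inv′} (G : IsGroup _≡_ op e inv) (G′ : IsGroup _≡_ op e′ inv′) where

  identity-unique : e ≡ e′
  identity-unique = trans (sym (IsGroup.identityʳ G′ e)) (IsGroup.identityˡ G e′)

  inverse-unique : ∀ x → inv x ≡ inv′ x
  inverse-unique x = GroupProperties.inverseʳ-unique group′ x (inv x) (trans (IsGroup.inverseʳ G x) identity-unique)
    where group′ : Group _ _
          group′ = record { isGroup = G′ }

  IsNormalSubgroup-transport : ∀ {S} → IsNormalSubgroup op e inv S → IsNormalSubgroup op e′ inv′ S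
  IsNormalSubgroup-transport {S} S-normal = record
    { ident∈      = subst (_∈ S) identity-unique ident∈
    ; op-closed   = op-closed
    ; inv-closed  = λ {x} x∈S → subst (_∈ S) (inverse-unique x) (inv-closed x∈S)
    ; conj-closed = λ g {x} x∈S → subst (λ i → op (op g x) i ∈ S) (inverse-unique g) (conj-closed g x∈S)
    }
    where open IsNormalSubgroup S-normal

simple⇒trivial-or-full : ∀ {n} {op : Op n} {e inv S} → IsSimpleGroup op → IsGroup _≡_ op e inv →
                IsNormalSubgroup op e inv S → S ≡ ⁅ e ⁆ ⊎ S ≡ Full
simple⇒trivial-or-full (e′ , inv′ , G′ , _ , simple) G S-normal with simple _ (IsNormalSubgroup-transport G G′ S-normal)
... | inj₁ S≡⁅e′⁆ = inj₁ (trans S≡⁅e′⁆ (cong ⁅_⁆ (sym (identity-unique G G′))))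
... | inj₂ S≡Full = inj₂ S≡Full

module _ {N} .{{_ : NonZero N}} where

  multiples∈ : ∀ {S : Subset N} → 0ₘ ∈ S → (∀ {x y} → x ∈ S → y ∈ S → x +ₘ y ∈ S) →
               ∀ {x} → x ∈ S → ∀ k → fromℤ (+ k * toℤ x) ∈ S
  multiples∈ {S} 0∈S +-closed {x} x∈S zero = subst (_∈ S) (cong fromℤ (sym (ℤₚ.*-zeroˡ (toℤ x)))) 0∈S
  multiples∈ {S} 0∈S +-closed {x} x∈S (suc k) =
    subst (_∈ S) (fromℤ-cong (begin
      toℤ (fromℤ (+ k * toℤ x)) + toℤ x    ≈⟨ +-congʳ-mod (toℤ x) (toℤ-fromℤ _) ⟩
      + k * toℤ x + toℤ x                  ≡⟨ step (+ k) (toℤ x) ⟩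
      (1ℤ + + k) * toℤ x                   ∎))
      (+-closed (multiples∈ 0∈S +-closed x∈S k) x∈S)
    where open ≡-mod-Reasoning N
          step : ∀ K t → K * t + t ≡ (1ℤ + K) * t
          step = solve-∀

  unit-generates : ∀ {S : Subset N} → 0ₘ ∈ S → (∀ {x y} → x ∈ S → y ∈ S → x +ₘ y ∈ S) →
                   ∀ {x u} → toℤ x * u ≡ 1ℤ [mod N ] → x ∈ S → ∀ y → y ∈ S
  unit-generates {S} 0∈S +-closed {x} {u} xu≡1 x∈S y =
    subst (_∈ S) y-as-multiple (multiples∈ 0∈S +-closed x∈S (toℕ (fromℤ {N} (toℤ y * u))))
    where
      open ≡-mod-Reasoning N
      y-as-multiple : fromℤ (toℤ (fromℤ (toℤ y * u)) * toℤ x) ≡ y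
      y-as-multiple = trans (fromℤ-cong (begin
        toℤ (fromℤ (toℤ y * u)) * toℤ x   ≈⟨ *-congʳ-mod (toℤ x) (toℤ-fromℤ _) ⟩
        toℤ y * u * toℤ x                 ≡⟨ regroup (toℤ y) u (toℤ x) ⟩
        toℤ y * (toℤ x * u)               ≈⟨ *-congˡ-mod (toℤ y) xu≡1 ⟩
        toℤ y * 1ℤ                        ≡⟨ ℤₚ.*-identityʳ (toℤ y) ⟩
        toℤ y                             ∎)) (fromℤ-toℤ y)
        where regroup : ∀ y u x → y * u * x ≡ y * (x * u)
              regroup = solve-∀

ℤ/prime-simple : ∀ {p} .{{_ : NonZero p}} → Prime p → IsSimpleGroup (ℤ/ p)
ℤ/prime-simple {p} p-prime =
  0ₘ , -ₘ_ , +ₘ-isGroup , (fromℤ 1ℤ , fromℤ-small≢0ₘ 1 (ℕ.nonTrivial⇒n>1 p {{prime⇒nonTrivial p-prime}})) ,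
  λ S S-normal → let open IsNormalSubgroup S-normal in
    trivial-or-full S ident∈ (λ {x} x∈S x≢0 →
      let (u , xu≡1) = prime-SmallUnits p-prime (Finₚ.toℕ<n x) (toℤ≢0 x≢0) ℕₚ.≤-refl
      in unit-generates ident∈ op-closed xu≡1 x∈S)

module _ (d m : ℕ) (1<d : 1 < d) (1<m : 1 < m) .{{_ : NonZero (d ℕ.* m)}} where

  private
    N = d ℕ.* m
    instance
      d≢0 : NonZero d
      d≢0 = ℕ.>-nonZero (ℕₚ.<-trans ℕ.z<s 1<d)

  Multiples : Subset N
  Multiples = tabulate (λ x → does (+ d ∣? toℤ x))

  ∈Multiples⇔ : ∀ {x} → x ∈ Multiples ⇔ + d ∣ toℤ x
  ∈Multiples⇔ = ∈-tabulate-does⇔ (λ x → + d ∣? toℤ x)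

  private
    d∣N : + d ∣ + N
    d∣N = ℤᵈ.∣ᵤ⇒∣ (ℕᵈ.m∣m*n m)

  d∣-resp-≡-mod : ∀ {x y} → x ≡ y [mod N ] → + d ∣ y → + d ∣ x
  d∣-resp-≡-mod {x} {y} (mod-divides N∣x-y) d∣y =
    subst (+ d ∣_) (cancel x y) (ℤᵈ.∣m∣n⇒∣m+n (ℤᵈ.∣-trans d∣N N∣x-y) d∣y)
    where cancel : ∀ x y → x - y + y ≡ x
          cancel = solve-∀

  Multiples-normal : IsNormalSubgroup (ℤ/ N) 0ₘ -ₘ_ Multiples
  Multiples-normal = record
    { ident∈      = from ∈Multiples⇔ (d∣-resp-≡-mod toℤ-0ₘ (divides 0ℤ refl))
    ; op-closed   = λ {x} {y} x∈ y∈ → from ∈Multiples⇔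
                      (d∣-resp-≡-mod (toℤ-+ₘ x y) (ℤᵈ.∣m∣n⇒∣m+n (to ∈Multiples⇔ x∈) (to ∈Multiples⇔ y∈)))
    ; inv-closed  = λ {x} x∈ → from ∈Multiples⇔ (d∣-resp-≡-mod (toℤ-negₘ x) (ℤᵈ.∣m⇒∣-m (to ∈Multiples⇔ x∈)))
    ; conj-closed = λ g {x} x∈ → subst (_∈ Multiples) (sym (+ₘ-conj g x)) x∈
    }
    where open Equivalence

  ℤ/composite-not-simple : ¬ IsSimpleGroup (ℤ/ N)
  ℤ/composite-not-simple simple with simple⇒trivial-or-full simple +ₘ-isGroup Multiples-normal
  ... | inj₁ M≡⁅0⁆ = fromℤ-small≢0ₘ d (ℕₚ.m<m*n d m 1<m)
                       (x∈⁅y⁆⇒x≡y 0ₘ (subst (fromℤ (+ d) ∈_) M≡⁅0⁆ d∈M))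
    where d∈M = Equivalence.from ∈Multiples⇔ (d∣-resp-≡-mod (toℤ-fromℤ (+ d)) ℤᵈ.∣-refl)
  ... | inj₂ M≡Full = contradiction (ℕᵈ.∣1⇒≡1 (ℤᵈ.∣⇒∣ᵤ d∣1)) (ℕₚ.>⇒≢ 1<d)
    where d∣1 = d∣-resp-≡-mod (≡-mod-sym (toℤ-fromℤ 1ℤ))
                  (Equivalence.to ∈Multiples⇔ (subst (fromℤ 1ℤ ∈_) (sym M≡Full) ∈⊤))

prime-square-agree : ∀ {p T} .{{_ : NonZero p}} .{{_ : NonZero (p ℕ.* p)}} → Prime p → T < p →
                     (φ : Sentence) → complexity φ ≤ T → (ℤ/ p ⊨ φ) ⇔ (ℤ/ (p ℕ.* p) ⊨ φ)
prime-square-agree {p} p-prime T<p =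
  Transfer.transfer-sentence (prime-SmallUnits p-prime T<p) (prime²-SmallUnits p-prime T<p)
                             T<p (ℕₚ.<-≤-trans T<p (ℕₚ.m≤m*n p p))

proposition3p1 : ¬ (Σ (List Sentence) λ Φ →
                      (n : ℕ) (op : Op n) → (All (λ φ → op ⊨ φ) Φ ⇔ IsSimpleGroup op))
proposition3p1 (Φ , Φ-axiomatizes) with prime> (max 0 (List.map complexity Φ))
... | p , p-prime , T<p = ℤ/composite-not-simple p p p>1 p>1 ℤ/p²-simple
  where
    instance
      p≢0 : NonZero p
      p≢0 = prime⇒nonZero p-prime
      p²≢0 : NonZero (p ℕ.* p)
      p²≢0 = ℕₚ.m*n≢0 p p

    p>1 : 1 < p
    p>1 = ℕ.nonTrivial⇒n>1 p {{prime⇒nonTrivial p-prime}}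

    ℤ/p⊨Φ : All (ℤ/ p ⊨_) Φ
    ℤ/p⊨Φ = Equivalence.from (Φ-axiomatizes p (ℤ/ p)) (ℤ/prime-simple p-prime)

    ℤ/p²⊨Φ : All (ℤ/ (p ℕ.* p) ⊨_) Φ
    ℤ/p²⊨Φ = All.zipWith (λ {φ} (φ≤T , ℤ/p⊨φ) → Equivalence.to (prime-square-agree p-prime T<p φ φ≤T) ℤ/p⊨φ)
                         (map⁻ (xs≤max 0 (List.map complexity Φ)) , ℤ/p⊨Φ)

    ℤ/p²-simple : IsSimpleGroup (ℤ/ (p ℕ.* p))
    ℤ/p²-simple = Equivalence.to (Φ-axiomatizes (p ℕ.* p) (ℤ/ (p ℕ.* p))) ℤ/p²⊨Φ
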